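{- Let $\alpha\in[0,1]$ and let $\mathbb Z_n$ be the cyclic group of order $n\ge3$. Then $\alpha n-1$ is an $A_\alpha$-eigenvalue of the power graph $\mathcal P(\mathbb Z_n)$ with multiplicity at least $\phi(n)$, where $\phi$ is Euler's totient function.
   Context: For a simple graph $G$ with adjacency matrix $A(G)$ and diagonal degree matrix $D(G)$, and $\alpha\in[0,1]$, $A_\alpha(G)=\alpha D(G)+(1-\alpha)A(G)$; an $A_\alpha$-eigenvalue is an eigenvalue of this matrix. The power graph $\mathcal P(\mathcal G)$ of a finite group $\mathcal G$ has vertex set $\mathcal G$, two distinct elements $x,y$ being adjacent iff one is a positive power of the other. -}

module Defs where

open import Level using (Level; _⊔_) renaming (suc to lsuc)
open import Data.Nat as ℕ using (ℕ; zero; suc; _≡ᵇ_)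
open import Data.Nat.DivMod using (_%_)
open import Data.Nat.GCD using (gcd)
open import Data.Bool using (Bool; true; false; if_then_else_; not; _∧_; _∨_)
open import Data.Fin as Fin using (Fin; toℕ)
open import Data.Fin.Properties using () renaming (_≟_ to _≟ᶠ_)
open import Data.List using (List; upTo; map; length; filter)
open import Data.Bool.ListAction using (any)
open import Data.Product using (Σ; ∃; _×_; _,_)
open import Relation.Nullary using (¬_; does)
open import Relation.Binary using (IsTotalOrder)
open import Algebra.Bundles using (CommutativeRing)

-- Ordered fields (the stdlib has no reals; ℝ is an instance of this).

record OrderedField c ℓ₁ ℓ₂ : Set (lsuc (c ⊔ ℓ₁ ⊔ ℓ₂)) where
  field
    commRing : CommutativeRing c ℓ₁
  open CommutativeRing commRing public
  field
    _≤_          : Carrier → Carrier → Set ℓ₂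
    0≉1          : ¬ (0# ≈ 1#)
    inverse      : ∀ x → ¬ (x ≈ 0#) → ∃ λ y → x * y ≈ 1#
    isTotalOrder : IsTotalOrder _≈_ _≤_
    +-mono-≤     : ∀ {x y} z → x ≤ y → (x + z) ≤ (y + z)
    *-nonneg     : ∀ {x y} → 0# ≤ x → 0# ≤ y → 0# ≤ (x * y)

-- In additive notation the k-th power of x is k·x mod n.  Since these are
-- periodic in k with period dividing n, "y is a positive power of x"
-- is decided by checking k = 1, …, n.

isPowerOf : (n : ℕ) → .{{_ : ℕ.NonZero n}} → Fin n → Fin n → Bool
isPowerOf n y x = any (λ k → ((suc k ℕ.* toℕ x) % n) ≡ᵇ toℕ y) (upTo n)

powAdj : (n : ℕ) → .{{_ : ℕ.NonZero n}} → Fin n → Fin n → Bool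
powAdj n x y = not (does (x ≟ᶠ y)) ∧ (isPowerOf n y x ∨ isPowerOf n x y)

powDeg : (n : ℕ) → .{{_ : ℕ.NonZero n}} → Fin n → ℕ
powDeg n x = length (filter (λ y → powAdj n x y Data.Bool.≟ true) (Data.List.allFin n))
  where import Data.Bool

φ : ℕ → ℕ
φ n = length (filter (λ k → gcd (suc k) n ℕ.≟ 1) (upTo n))

module _ {c ℓ₁ ℓ₂} (F : OrderedField c ℓ₁ ℓ₂) where
  open OrderedField F

  fromℕ : ℕ → Carrier
  fromℕ zero    = 0#
  fromℕ (suc m) = 1# + fromℕ m

  ∑ : (m : ℕ) → (Fin m → Carrier) → Carrier
  ∑ zero    f = 0#
  ∑ (suc m) f = f Fin.zero + ∑ m (λ i → f (Fin.suc i))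

  Matrix : ℕ → Set c
  Matrix m = Fin m → Fin m → Carrier

  bool→F : Bool → Carrier
  bool→F b = if b then 1# else 0#

  adjMatrix : (n : ℕ) → .{{_ : ℕ.NonZero n}} → Matrix n
  adjMatrix n x y = bool→F (powAdj n x y)

  degMatrix : (n : ℕ) → .{{_ : ℕ.NonZero n}} → Matrix n
  degMatrix n x y = if does (x ≟ᶠ y) then fromℕ (powDeg n x) else 0#

  Aα : (α : Carrier) (n : ℕ) → .{{_ : ℕ.NonZero n}} → Matrix n
  Aα α n x y = (α * degMatrix n x y) + ((1# - α) * adjMatrix n x y)

  IsEigenvector : {m : ℕ} → Matrix m → Carrier → (Fin m → Carrier) → Set ℓ₁
  IsEigenvector {m} M λ′ v =
    (¬ (∀ i → v i ≈ 0#)) × (∀ i → ∑ m (λ j → M i j * v j) ≈ (λ′ * v i))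

  -- λ is an eigenvalue of M with (geometric) multiplicity at least k:
  -- there are k linearly independent eigenvectors for λ.
  EigenvalueMultAtLeast : {m : ℕ} → Matrix m → Carrier → ℕ → Set (c ⊔ ℓ₁)
  EigenvalueMultAtLeast {m} M λ′ k =
    Σ (Fin k → Fin m → Carrier) λ v →
      (∀ i → IsEigenvector M λ′ (v i)) ×
      (∀ (a : Fin k → Carrier) →
         (∀ j → ∑ k (λ i → a i * v i j) ≈ 0#) → ∀ i → a i ≈ 0#)

module Submission where

-- In P(ℤ_n) the identity 0 and each of the φ(n) generators are adjacent to every other vertex:
-- 0 is a multiple of everything, and every element is a multiple of a generator.  For two such
-- dominating vertices x ≠ y, columns x and y of A_α are (1 - α) + μ e_x and (1 - α) + μ e_y with
-- μ = α (n - 1) - (1 - α) = α n - 1, so e_x - e_y is a μ-eigenvector.  The vectors e_g - e_0, g a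
-- generator, are linearly independent: the g-coordinate of a combination is the coefficient of g.

open import Defs
open import Data.Nat using (ℕ; _≤_; NonZero; zero; suc; pred; _<_; s≤s)
open import Data.Nat.Coprimality using (Coprime)
open import Data.Bool using (Bool; true; false; not; _∧_)
open import Data.Bool.Properties using (T-≡; ∨-comm; ∨-zeroʳ) renaming (_≟_ to _≟ᵇ_)
open import Data.Fin using (Fin; zero; suc; toℕ; fromℕ<)
open import Data.Fin.Properties using (toℕ<n; toℕ-fromℕ<) renaming (suc-injective to Fin-suc-injective; _≟_ to _≟ᶠ_)
open import Data.List using (List; length; filter; tabulate; upTo; lookup)
open import Data.List.Properties using (filter-accept; filter-reject; filter-all; length-tabulate)
open import Data.List.Relation.Unary.All.Properties using (tabulate⁺)
open import Data.List.Membership.Propositional.Properties using (∈-lookup)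
open import Data.List.Relation.Unary.Unique.Propositional using (Unique)
open import Data.List.Relation.Unary.AllPairs using (_∷_)
import Data.List.Relation.Unary.All as All
open import Data.Product using (_,_)
open import Function using (_∘_; id; case_of_)
open import Function.Bundles using (Equivalence)
open import Relation.Nullary using (¬_; Dec; does; yes; no; contradiction)
open import Relation.Nullary.Decidable using (dec-true; dec-false)
open import Relation.Binary.PropositionalEquality using (_≡_; _≢_; refl; sym; trans; cong; cong₂; subst; module ≡-Reasoning)

does-≟-sym : ∀ {m} (x y : Fin m) → does (x ≟ᶠ y) ≡ does (y ≟ᶠ x)
does-≟-sym zero    zero    = refl
does-≟-sym zero    (suc y) = refl
does-≟-sym (suc x) zero    = refl
does-≟-sym (suc x) (suc y) = does-≟-sym x y

length-filter-tabulate-allBut : ∀ {a} {A : Set a} {m} (f : Fin m → A) (b : A → Bool) (x : Fin m) →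
  b (f x) ≡ false → (∀ y → y ≢ x → b (f y) ≡ true) →
  length (filter (λ a → b a ≟ᵇ true) (tabulate f)) ≡ pred m
length-filter-tabulate-allBut {m = suc m} f b zero bx≡false others = begin
  length (filter P? (tabulate f))          ≡⟨ cong length (filter-reject P? λ bx≡true → case trans (sym bx≡false) bx≡true of λ ()) ⟩
  length (filter P? (tabulate (f ∘ suc)))  ≡⟨ cong length (filter-all P? (tabulate⁺ λ y → others (suc y) λ ())) ⟩
  length (tabulate (f ∘ suc))              ≡⟨ length-tabulate (f ∘ suc) ⟩
  m                                        ∎
  where
  open ≡-Reasoning
  P? = λ a → b a ≟ᵇ true
length-filter-tabulate-allBut {m = suc (suc m)} f b (suc x) bx≡false others =
  trans (cong length (filter-accept (λ a → b a ≟ᵇ true) (others zero λ ())))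
        (cong suc (length-filter-tabulate-allBut (f ∘ suc) b x bx≡false λ y y≢x → others (suc y) (y≢x ∘ Fin-suc-injective)))

Unique⇒lookup-injective : ∀ {a} {A : Set a} {xs : List A} → Unique xs → ∀ {i j} → lookup xs i ≡ lookup xs j → i ≡ j
Unique⇒lookup-injective (_ ∷ _)    {zero}  {zero}  _  = refl
Unique⇒lookup-injective (x∉ ∷ _)   {zero}  {suc j} eq = contradiction eq (All.lookup x∉ (∈-lookup j))
Unique⇒lookup-injective (x∉ ∷ _)   {suc i} {zero}  eq = contradiction (sym eq) (All.lookup x∉ (∈-lookup i))
Unique⇒lookup-injective (_ ∷ uniq) {suc i} {suc j} eq = cong suc (Unique⇒lookup-injective uniq eq)

module _ {n : ℕ} .{{_ : NonZero n}} where

  open import Data.Nat using (_+_; _*_; _≡ᵇ_)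
  open import Data.Nat.Properties using (≡⇒≡ᵇ; *-assoc; *-comm; *-identityˡ; +-suc; suc-pred)
  open import Data.Nat.DivMod using (_%_; %-distribˡ-+; %-distribˡ-*; m%n%n≡m%n; [m+n]%n≡m%n; [m+kn]%n≡m%n; m%n<n; m<n⇒m%n≡m)
  open import Data.Nat.Coprimality using (coprime-Bézout)
  open import Data.Nat.GCD using (module Bézout)
  open import Data.Nat.Tactic.RingSolver using (solve-∀)
  open import Data.List.Relation.Unary.Any.Properties using (any⁺)
  open import Data.List.Membership.Propositional using (lose)
  open import Data.List.Membership.Propositional.Properties using (∈-upTo⁺)
  open import Data.Product using (∃)
  open ≡-Reasoning

  %-congˡ-* : ∀ {m m′} o → m % n ≡ m′ % n → (m * o) % n ≡ (m′ * o) % n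
  %-congˡ-* {m} {m′} o eq = begin
    (m * o) % n               ≡⟨ %-distribˡ-* m o n ⟩
    ((m % n) * (o % n)) % n   ≡⟨ cong (λ r → (r * (o % n)) % n) eq ⟩
    ((m′ % n) * (o % n)) % n  ≡⟨ %-distribˡ-* m′ o n ⟨
    (m′ * o) % n              ∎

  [1+m%n]%n≡[1+m]%n : ∀ m → suc (m % n) % n ≡ suc m % n
  [1+m%n]%n≡[1+m]%n m = begin
    (1 + m % n) % n          ≡⟨ %-distribˡ-+ 1 (m % n) n ⟩
    (1 % n + m % n % n) % n  ≡⟨ cong (λ r → (1 % n + r) % n) (m%n%n≡m%n m n) ⟩
    (1 % n + m % n) % n      ≡⟨ %-distribˡ-+ 1 m n ⟨
    (1 + m) % n              ∎

  coprime⇒inverse : ∀ {x} → Coprime x n → ∃ λ a → (a * x) % n ≡ 1 % n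
  coprime⇒inverse {x} cop with coprime-Bézout cop
  ... | Bézout.+- a b eq = a , (begin
    (a * x) % n      ≡⟨ cong (_% n) eq ⟨
    (1 + b * n) % n  ≡⟨ [m+kn]%n≡m%n 1 b n ⟩
    1 % n            ∎)
  -- Here u = a x ≡ -1 (mod n), hence u² ≡ 1 (mod n).
  ... | Bézout.-+ a b eq = a * a * x , (begin
    (a * a * x * x) % n        ≡⟨ cong (_% n) (regroup a x) ⟩
    (u * u) % n                ≡⟨ [m+kn]%n≡m%n (u * u) (2 * b) n ⟨
    (u * u + 2 * b * n) % n    ≡⟨ cong (λ t → (u * u + t) % n) (*-assoc 2 b n) ⟩
    (u * u + 2 * (b * n)) % n  ≡⟨ cong (_% n) (1+u≡v⇒u*u+2v≡1+v*v eq) ⟩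
    (1 + b * n * (b * n)) % n  ≡⟨ cong (λ t → (1 + t) % n) (regroup b n) ⟨
    (1 + b * b * n * n) % n    ≡⟨ [m+kn]%n≡m%n 1 (b * b * n) n ⟩
    1 % n                      ∎)
    where
    u = a * x
    regroup : ∀ a x → a * a * x * x ≡ a * x * (a * x)
    regroup = solve-∀
    square-identity : ∀ u → u * u + 2 * (1 + u) ≡ 1 + (1 + u) * (1 + u)
    square-identity = solve-∀
    1+u≡v⇒u*u+2v≡1+v*v : ∀ {u v} → 1 + u ≡ v → u * u + 2 * v ≡ 1 + v * v
    1+u≡v⇒u*u+2v≡1+v*v {u} refl = square-identity u

  -- The powers of x are periodic with period n, so any multiple m x is a positive power k x, k ∈ [1, n].
  multiple⇒isPowerOf : ∀ {x y : Fin n} m → (m * toℕ x) % n ≡ toℕ y → isPowerOf n y x ≡ true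
  multiple⇒isPowerOf {x} {y} m mx≡y =
    Equivalence.to T-≡ (any⁺ test (lose (∈-upTo⁺ (m%n<n (m + pred n) n)) (Equivalence.from T-≡ hit)))
    where
    test : ℕ → Bool
    test k = ((suc k * toℕ x) % n) ≡ᵇ toℕ y
    k = (m + pred n) % n
    1+k≡m : suc k % n ≡ m % n
    1+k≡m = begin
      suc ((m + pred n) % n) % n  ≡⟨ [1+m%n]%n≡[1+m]%n (m + pred n) ⟩
      suc (m + pred n) % n        ≡⟨ cong (_% n) (+-suc m (pred n)) ⟨
      (m + suc (pred n)) % n      ≡⟨ cong (λ t → (m + t) % n) (suc-pred n) ⟩
      (m + n) % n                 ≡⟨ [m+n]%n≡m%n m n ⟩
      m % n                       ∎
    hit : test k ≡ true
    hit = Equivalence.to T-≡ (≡⇒≡ᵇ _ _ (trans (%-congˡ-* (toℕ x) 1+k≡m) mx≡y))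

  coprime⇒everyPowerOf : ∀ {x : Fin n} → Coprime (toℕ x) n → ∀ y → isPowerOf n y x ≡ true
  coprime⇒everyPowerOf {x} cop y with coprime⇒inverse cop
  ... | a , ax≡1 = multiple⇒isPowerOf (toℕ y * a) (begin
    (toℕ y * a * toℕ x) % n    ≡⟨ cong (_% n) (*-assoc (toℕ y) a (toℕ x)) ⟩
    (toℕ y * (a * toℕ x)) % n  ≡⟨ cong (_% n) (*-comm (toℕ y) (a * toℕ x)) ⟩
    (a * toℕ x * toℕ y) % n    ≡⟨ %-congˡ-* (toℕ y) ax≡1 ⟩
    (1 * toℕ y) % n            ≡⟨ cong (_% n) (*-identityˡ (toℕ y)) ⟩
    toℕ y % n                  ≡⟨ m<n⇒m%n≡m (toℕ<n y) ⟩
    toℕ y                      ∎)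

  powAdj-irreflexive : ∀ (x : Fin n) → powAdj n x x ≡ false
  powAdj-irreflexive x rewrite dec-true (x ≟ᶠ x) refl = refl

  powAdj-sym : ∀ (x y : Fin n) → powAdj n x y ≡ powAdj n y x
  powAdj-sym x y = cong₂ (λ b c → not b ∧ c) (does-≟-sym x y) (∨-comm (isPowerOf n y x) (isPowerOf n x y))

  Dominating : Fin n → Set
  Dominating x = ∀ y → y ≢ x → powAdj n y x ≡ true

  everyPowerOf⇒dominating : ∀ {x} → (∀ y → isPowerOf n y x ≡ true) → Dominating x
  everyPowerOf⇒dominating {x} powers y y≢x
    rewrite dec-false (y ≟ᶠ x) y≢x | powers y = ∨-zeroʳ (isPowerOf n x y)

  powerOfEvery⇒dominating : ∀ {x} → (∀ y → isPowerOf n x y ≡ true) → Dominating x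
  powerOfEvery⇒dominating {x} powerOf y y≢x
    rewrite dec-false (y ≟ᶠ x) y≢x | powerOf y = refl

  dominating⇒powDeg : ∀ {x} → Dominating x → powDeg n x ≡ pred n
  dominating⇒powDeg {x} dom = length-filter-tabulate-allBut id (powAdj n x) x (powAdj-irreflexive x)
    λ y y≢x → trans (powAdj-sym x y) (dom y y≢x)

zero-isPowerOf : ∀ {m} (y : Fin (suc m)) → isPowerOf (suc m) zero y ≡ true
zero-isPowerOf y = multiple⇒isPowerOf {x = y} {y = zero} 0 refl

module Generators (q : ℕ) where

  open import Data.Nat using (_+_; _≟_)
  open import Data.Nat.Properties using (≤∧≢⇒<; suc-injective)
  open import Data.Nat.Coprimality using (gcd≡1⇒coprime)
  open import Data.Nat.Divisibility using (∣-refl)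
  open import Data.Nat.GCD using (gcd)
  open import Data.List.Membership.Propositional.Properties using (∈-upTo⁻; ∈-filter⁻)
  open import Data.List.Relation.Unary.Unique.Propositional.Properties using (upTo⁺; filter⁺)
  open import Data.Product using (proj₁; proj₂)

  -- The k-th residue counted by φ n is the generator k + 1; it is < n because n is not coprime to itself.
  private
    n : ℕ
    n = 2 + q

    coprime? : ∀ k → Dec (gcd (suc k) n ≡ 1)
    coprime? k = gcd (suc k) n ≟ 1

    residues : List ℕ
    residues = filter coprime? (upTo n)

    residue<n : ∀ i → lookup residues i < n
    residue<n i = ∈-upTo⁻ (proj₁ (∈-filter⁻ coprime? (∈-lookup i)))

    residue-coprime : ∀ i → Coprime (suc (lookup residues i)) n
    residue-coprime i = gcd≡1⇒coprime (proj₂ (∈-filter⁻ coprime? {xs = upTo n} (∈-lookup i)))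

    generator< : ∀ i → suc (lookup residues i) < n
    generator< i = ≤∧≢⇒< (residue<n i) λ 1+k≡n →
      case subst (λ m → Coprime m n) 1+k≡n (residue-coprime i) (∣-refl , ∣-refl) of λ ()

  generator : Fin (φ n) → Fin n
  generator i = fromℕ< (generator< i)

  private
    toℕ-generator : ∀ i → toℕ (generator i) ≡ suc (lookup residues i)
    toℕ-generator i = toℕ-fromℕ< (generator< i)

  generator-coprime : ∀ i → Coprime (toℕ (generator i)) n
  generator-coprime i = subst (λ m → Coprime m n) (sym (toℕ-generator i)) (residue-coprime i)

  generator≢zero : ∀ i → generator i ≢ zero
  generator≢zero i eq = case trans (sym (toℕ-generator i)) (cong toℕ eq) of λ ()

  generator-injective : ∀ {i j} → generator i ≡ generator j → i ≡ j
  generator-injective {i} {j} eq = Unique⇒lookup-injective (filter⁺ coprime? (upTo⁺ n))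
    (suc-injective (trans (sym (toℕ-generator i)) (trans (cong toℕ eq) (toℕ-generator j))))

module _ {c ℓ₁ ℓ₂} (F : OrderedField c ℓ₁ ℓ₂) where

  open OrderedField F hiding (zero) renaming (refl to ≈-refl; sym to ≈-sym; trans to ≈-trans)
  open import Algebra.Properties.AbelianGroup +-abelianGroup using (⁻¹-∙-comm; ⁻¹-anti-homo‿-)
  open import Algebra.Properties.CommutativeSemigroup +-commutativeSemigroup using (interchange; xy∙z≈y∙xz)
  open import Algebra.Properties.Ring ring using (x[y-z]≈xy-xz; -0#≈0#)
  open import Relation.Binary.Reasoning.Setoid setoid

  a-0≈a : ∀ a → a - 0# ≈ a
  a-0≈a a = ≈-trans (+-congˡ -0#≈0#) (+-identityʳ a)

  [a-b]+[c-d]≈[a+c]-[b+d] : ∀ a b c d → (a - b) + (c - d) ≈ (a + c) - (b + d)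
  [a-b]+[c-d]≈[a+c]-[b+d] a b c d = ≈-trans (interchange a (- b) c (- d)) (+-congˡ (⁻¹-∙-comm b d))

  [c+a]-[c+b]≈a-b : ∀ c a b → (c + a) - (c + b) ≈ a - b
  [c+a]-[c+b]≈a-b c a b = begin
    (c + a) - (c + b)  ≈⟨ [a-b]+[c-d]≈[a+c]-[b+d] c c a b ⟨
    (c - c) + (a - b)  ≈⟨ +-congʳ (-‿inverseʳ c) ⟩
    0# + (a - b)       ≈⟨ +-identityˡ (a - b) ⟩
    a - b              ∎

  b+[a-b]≈a : ∀ a b → b + (a - b) ≈ a
  b+[a-b]≈a a b = begin
    b + (a - b)    ≈⟨ +-comm b (a - b) ⟩
    (a - b) + b    ≈⟨ +-assoc a (- b) b ⟩
    a + (- b + b)  ≈⟨ +-congˡ (-‿inverseˡ b) ⟩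
    a + 0#         ≈⟨ +-identityʳ a ⟩
    a              ∎

  α[1+d]-1≈αd-[1-α] : ∀ α d → α * (1# + d) - 1# ≈ α * d - (1# - α)
  α[1+d]-1≈αd-[1-α] α d = begin
    α * (1# + d) - 1#   ≈⟨ +-congʳ (≈-trans (distribˡ α 1# d) (+-congʳ (*-identityʳ α))) ⟩
    (α + α * d) - 1#    ≈⟨ xy∙z≈y∙xz α (α * d) (- 1#) ⟩
    α * d + (α - 1#)    ≈⟨ +-congˡ (⁻¹-anti-homo‿- 1# α) ⟨
    α * d - (1# - α)    ∎

  𝟙 : ∀ {m} → Fin m → Fin m → Carrier
  𝟙 a j = bool→F F (does (j ≟ᶠ a))

  𝟙-diag : ∀ {m} (a : Fin m) → 𝟙 a a ≡ 1#
  𝟙-diag a rewrite dec-true (a ≟ᶠ a) refl = refl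

  𝟙-offDiag : ∀ {m} {a j : Fin m} → j ≢ a → 𝟙 a j ≡ 0#
  𝟙-offDiag {a = a} {j} j≢a rewrite dec-false (j ≟ᶠ a) j≢a = refl

  𝟙-sym : ∀ {m} (a j : Fin m) → 𝟙 a j ≡ 𝟙 j a
  𝟙-sym a j = cong (bool→F F) (does-≟-sym j a)

  𝟙-reindex : ∀ {k m} {g : Fin k → Fin m} → (∀ {i j} → g i ≡ g j → i ≡ j) → ∀ a j → 𝟙 (g a) (g j) ≡ 𝟙 a j
  𝟙-reindex {g = g} g-injective a j with j ≟ᶠ a
  ... | yes refl = 𝟙-diag (g a)
  ... | no j≢a   = 𝟙-offDiag (j≢a ∘ g-injective)

  ∑-cong : ∀ m {f g : Fin m → Carrier} → (∀ i → f i ≈ g i) → ∑ F m f ≈ ∑ F m g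
  ∑-cong zero    f≈g = ≈-refl
  ∑-cong (suc m) f≈g = +-cong (f≈g zero) (∑-cong m (f≈g ∘ suc))

  ∑-zero : ∀ m {f : Fin m → Carrier} → (∀ i → f i ≈ 0#) → ∑ F m f ≈ 0#
  ∑-zero zero    f≈0 = ≈-refl
  ∑-zero (suc m) f≈0 = ≈-trans (+-cong (f≈0 zero) (∑-zero m (f≈0 ∘ suc))) (+-identityˡ 0#)

  ∑-distrib-- : ∀ m (f g : Fin m → Carrier) → ∑ F m (λ i → f i - g i) ≈ ∑ F m f - ∑ F m g
  ∑-distrib-- zero    f g = ≈-sym (a-0≈a 0#)
  ∑-distrib-- (suc m) f g =
    ≈-trans (+-congˡ (∑-distrib-- m (f ∘ suc) (g ∘ suc))) ([a-b]+[c-d]≈[a+c]-[b+d] _ _ _ _)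

  ∑-*-𝟙 : ∀ m (h : Fin m → Carrier) a → ∑ F m (λ j → h j * 𝟙 a j) ≈ h a
  ∑-*-𝟙 (suc m) h zero =
    ≈-trans (+-cong (*-identityʳ (h zero)) (∑-zero m λ j → zeroʳ (h (suc j)))) (+-identityʳ (h zero))
  ∑-*-𝟙 (suc m) h (suc a) =
    ≈-trans (+-cong (zeroʳ (h zero)) (∑-*-𝟙 m (h ∘ suc) a)) (+-identityˡ (h (suc a)))

  ∑-*-𝟙-𝟙 : ∀ m (h : Fin m → Carrier) a b → ∑ F m (λ j → h j * (𝟙 a j - 𝟙 b j)) ≈ h a - h b
  ∑-*-𝟙-𝟙 m h a b = begin
    ∑ F m (λ j → h j * (𝟙 a j - 𝟙 b j))                    ≈⟨ ∑-cong m (λ j → x[y-z]≈xy-xz (h j) (𝟙 a j) (𝟙 b j)) ⟩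
    ∑ F m (λ j → h j * 𝟙 a j - h j * 𝟙 b j)                ≈⟨ ∑-distrib-- m _ _ ⟩
    ∑ F m (λ j → h j * 𝟙 a j) - ∑ F m (λ j → h j * 𝟙 b j)  ≈⟨ +-cong (∑-*-𝟙 m h a) (-‿cong (∑-*-𝟙 m h b)) ⟩
    h a - h b                                               ∎

  IsEigenvector-resp-≈ : ∀ {m} {M : Matrix F m} {λ₁ λ₂ v} → λ₁ ≈ λ₂ → IsEigenvector F M λ₁ v → IsEigenvector F M λ₂ v
  IsEigenvector-resp-≈ λ₁≈λ₂ (v≉0 , Mv≈λ₁v) = v≉0 , λ i → ≈-trans (Mv≈λ₁v i) (*-congʳ λ₁≈λ₂)

  twinColumns⇒eigenvector : ∀ {m} (M : Matrix F m) (c μ : Carrier) {x y : Fin m} → x ≢ y →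
    (∀ r → M r x ≈ c + μ * 𝟙 x r) → (∀ r → M r y ≈ c + μ * 𝟙 y r) →
    IsEigenvector F M μ (λ j → 𝟙 x j - 𝟙 y j)
  twinColumns⇒eigenvector {m} M c μ {x} {y} x≢y column-x column-y = nonzero , eigen
    where
    nonzero : ¬ (∀ j → 𝟙 x j - 𝟙 y j ≈ 0#)
    nonzero v≈0 = 0≉1 (begin
      0#             ≈⟨ v≈0 x ⟨
      𝟙 x x - 𝟙 y x  ≡⟨ cong₂ _-_ (𝟙-diag x) (𝟙-offDiag x≢y) ⟩
      1# - 0#        ≈⟨ a-0≈a 1# ⟩
      1#             ∎)
    eigen : ∀ r → ∑ F m (λ j → M r j * (𝟙 x j - 𝟙 y j)) ≈ μ * (𝟙 x r - 𝟙 y r)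
    eigen r = begin
      ∑ F m (λ j → M r j * (𝟙 x j - 𝟙 y j))  ≈⟨ ∑-*-𝟙-𝟙 m (M r) x y ⟩
      M r x - M r y                          ≈⟨ +-cong (column-x r) (-‿cong (column-y r)) ⟩
      (c + μ * 𝟙 x r) - (c + μ * 𝟙 y r)      ≈⟨ [c+a]-[c+b]≈a-b c _ _ ⟩
      μ * 𝟙 x r - μ * 𝟙 y r                  ≈⟨ x[y-z]≈xy-xz μ (𝟙 x r) (𝟙 y r) ⟨
      μ * (𝟙 x r - 𝟙 y r)                    ∎

  unitDifferences-independent : ∀ {k m} (g : Fin k → Fin m) → (∀ {i j} → g i ≡ g j → i ≡ j) →
    (z : Fin m) → (∀ i → g i ≢ z) →
    ∀ (a : Fin k → Carrier) → (∀ j → ∑ F k (λ i → a i * (𝟙 (g i) j - 𝟙 z j)) ≈ 0#) → ∀ i → a i ≈ 0#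
  unitDifferences-independent {k} g g-injective z g≢z a combination≈0 i = begin
    a i                                                 ≈⟨ ∑-*-𝟙 k a i ⟨
    ∑ F k (λ i′ → a i′ * 𝟙 i i′)                        ≈⟨ ∑-cong k coordinate ⟨
    ∑ F k (λ i′ → a i′ * (𝟙 (g i′) (g i) - 𝟙 z (g i)))  ≈⟨ combination≈0 (g i) ⟩
    0#                                                  ∎
    where
    coordinate : ∀ i′ → a i′ * (𝟙 (g i′) (g i) - 𝟙 z (g i)) ≈ a i′ * 𝟙 i i′
    coordinate i′ = *-congˡ (begin
      𝟙 (g i′) (g i) - 𝟙 z (g i)  ≡⟨ cong₂ _-_ (trans (𝟙-reindex g-injective i′ i) (𝟙-sym i′ i)) (𝟙-offDiag (g≢z i)) ⟩
      𝟙 i i′ - 0#                 ≈⟨ a-0≈a (𝟙 i i′) ⟩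
      𝟙 i i′                      ∎)

  degMatrix-diag : ∀ {n} .{{_ : NonZero n}} (x : Fin n) → degMatrix F n x x ≡ fromℕ F (powDeg n x)
  degMatrix-diag x rewrite dec-true (x ≟ᶠ x) refl = refl

  degMatrix-offDiag : ∀ {n} .{{_ : NonZero n}} {r x : Fin n} → r ≢ x → degMatrix F n r x ≡ 0#
  degMatrix-offDiag {r = r} {x} r≢x rewrite dec-false (r ≟ᶠ x) r≢x = refl

  dominating⇒Aα-column : ∀ α {m} {x : Fin (suc m)} → Dominating x → ∀ r →
    Aα F α (suc m) r x ≈ (1# - α) + (α * fromℕ F m - (1# - α)) * 𝟙 x r
  dominating⇒Aα-column α {m} {x} dom r = column r (r ≟ᶠ x)
    where
    μ = α * fromℕ F m - (1# - α)
    column : ∀ r → Dec (r ≡ x) → Aα F α (suc m) r x ≈ (1# - α) + μ * 𝟙 x r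
    column _ (yes refl) = begin
      Aα F α (suc m) x x             ≡⟨ cong₂ (λ d a → α * d + (1# - α) * a)
                                          (trans (degMatrix-diag x) (cong (fromℕ F) (dominating⇒powDeg dom)))
                                          (cong (bool→F F) (powAdj-irreflexive x)) ⟩
      α * fromℕ F m + (1# - α) * 0#  ≈⟨ ≈-trans (+-congˡ (zeroʳ (1# - α))) (+-identityʳ _) ⟩
      α * fromℕ F m                  ≈⟨ b+[a-b]≈a (α * fromℕ F m) (1# - α) ⟨
      (1# - α) + μ                   ≈⟨ +-congˡ (*-identityʳ μ) ⟨
      (1# - α) + μ * 1#              ≡⟨ cong (λ u → (1# - α) + μ * u) (𝟙-diag x) ⟨
      (1# - α) + μ * 𝟙 x x           ∎
    column r (no r≢x) = begin
      Aα F α (suc m) r x             ≡⟨ cong₂ (λ d a → α * d + (1# - α) * a)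
                                          (degMatrix-offDiag r≢x) (cong (bool→F F) (dom r r≢x)) ⟩
      α * 0# + (1# - α) * 1#         ≈⟨ ≈-trans (+-cong (zeroʳ α) (*-identityʳ (1# - α))) (+-identityˡ (1# - α)) ⟩
      1# - α                         ≈⟨ ≈-trans (+-congˡ (zeroʳ μ)) (+-identityʳ (1# - α)) ⟨
      (1# - α) + μ * 0#              ≡⟨ cong (λ u → (1# - α) + μ * u) (𝟙-offDiag r≢x) ⟨
      (1# - α) + μ * 𝟙 x r           ∎

  Aα-eigenvalue-multiplicity : ∀ α q →
    EigenvalueMultAtLeast F (Aα F α (suc (suc q))) (α * fromℕ F (suc (suc q)) - 1#) (φ (suc (suc q)))
  Aα-eigenvalue-multiplicity α q =
    v , eigenvector , unitDifferences-independent generator generator-injective zero generator≢zero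
    where
    open Generators q
    n = suc (suc q)
    v : Fin (φ n) → Fin n → Carrier
    v i j = 𝟙 (generator i) j - 𝟙 zero j
    eigenvector : ∀ i → IsEigenvector F (Aα F α n) (α * fromℕ F n - 1#) (v i)
    eigenvector i = IsEigenvector-resp-≈ {M = Aα F α n} (≈-sym (α[1+d]-1≈αd-[1-α] α (fromℕ F (suc q))))
      (twinColumns⇒eigenvector (Aα F α n) (1# - α) _ (generator≢zero i)
        (dominating⇒Aα-column α (everyPowerOf⇒dominating (coprime⇒everyPowerOf (generator-coprime i))))
        (dominating⇒Aα-column α (powerOfEvery⇒dominating zero-isPowerOf)))

corollary3p2 : ∀ {c ℓ₁ ℓ₂} (F : OrderedField c ℓ₁ ℓ₂) →
    let open OrderedField F renaming (_≤_ to _≤F_) in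
    (α : Carrier) → 0# ≤F α → α ≤F 1# →
    (n : ℕ) → .{{_ : NonZero n}} → 3 ≤ n →
    EigenvalueMultAtLeast F (Aα F α n) ((α * fromℕ F n) - 1#) (φ n)
corollary3p2 F α _ _ (suc (suc q)) (s≤s (s≤s _)) = Aα-eigenvalue-multiplicity F α q
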